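{- Let $T$ be a (rooted or unrooted) phylogenetic tree with leaf set $X$ and let $\mathfrak{P}=\{\mathcal{P}_1,\dots,\mathcal{P}_k\}$ be a collection of partitions of $X$ that are all compatible with $T$. Then the common refinement $\bigwedge_{i=1}^k\mathcal{P}_i$ is compatible with $T$.
   Context: Rooted phylogenetic trees have every non-leaf vertex with at least two children; unrooted phylogenetic trees have every non-leaf vertex of degree at least three; in both cases the leaf set is $X$. For $H\subseteq E(T)$, $\mathcal{F}(T,H)$ is the partition of $X$ into leaf sets of the connected components of $T-H$; a partition $\mathcal{P}$ of $X$ is compatible with $T$ if $\mathcal{P}=\mathcal{F}(T,H)$ for some $H\subseteq E(T)$. The common refinement of partitions $\mathcal{P}_1,\mathcal{P}_2$ is $\mathcal{P}_1\wedge\mathcal{P}_2=\{A_1\cap A_2: A_1\in\mathcal{P}_1,A_2\in\mathcal{P}_2, A_1\cap A_2\neq\emptyset\}$; this operation is associative and commutative, and $\bigwedge_{i=1}^k\mathcal{P}_i$ denotes the iterated common refinement. -}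

module Defs where

open import Data.Nat using (ℕ; zero; suc)
open import Data.Fin using (Fin; zero; suc)
open import Data.Fin.Subset using (Subset; _∈_; _∩_; Nonempty)
open import Data.Product using (Σ; ∃; ∃-syntax; _×_; _,_)
open import Data.Sum using (_⊎_)
open import Relation.Nullary using (¬_)
open import Relation.Binary.PropositionalEquality using (_≡_; _≢_)
open import Relation.Binary.Construct.Closure.ReflexiveTransitive using (Star)
open import Function.Bundles using (_⇔_)
open import Function.Definitions using (Injective)

-- Graphs on vertex set Fin n; an (undirected) edge set is given by a
-- relation E, where {u,v} is an edge iff E u v (E symmetric, irreflexive).

Rel : ℕ → Set₁
Rel n = Fin n → Fin n → Set

_minus_ : ∀ {n} → Rel n → Rel n → Rel n
(E minus H) u v = E u v × ¬ H u v × ¬ H v u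

single : ∀ {n} → Fin n → Fin n → Rel n
single u v a b = a ≡ u × b ≡ v

Connected : ∀ {n} → Rel n → Fin n → Fin n → Set
Connected E = Star E

-- A tree: connected, and acyclic (every edge is a bridge: deleting
-- edge {u,v} disconnects u from v).
record IsTree {n : ℕ} (E : Rel n) : Set where
  field
    sym       : ∀ u v → E u v → E v u
    irrefl    : ∀ u → ¬ E u u
    connected : ∀ u v → Connected E u v
    acyclic   : ∀ u v → E u v → ¬ Connected (E minus single u v) u v

IsLeafU : ∀ {n} → Rel n → Fin n → Set
IsLeafU E v = ∀ a b → E v a → E v b → a ≡ b

-- Rooted at r: w is a child of v iff {v,w} is an edge and v lies on
-- the root side of that edge.
Child : ∀ {n} → Rel n → Fin n → Fin n → Fin n → Set
Child E r v w = E v w × Connected (E minus single v w) r v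

IsLeafR : ∀ {n} → Rel n → Fin n → Fin n → Set
IsLeafR E r v = ∀ w → ¬ Child E r v w

-- phylogenetic conditions; leaf : X → V is a bijection of X = Fin m
-- onto the set of leaves.
record IsUnrootedPhylo {m n : ℕ} (E : Rel n) (leaf : Fin m → Fin n) : Set where
  field
    leaves   : ∀ v → IsLeafU E v ⇔ (∃[ x ] leaf x ≡ v)
    internal : ∀ v → ¬ IsLeafU E v →
               ∃[ a ] ∃[ b ] ∃[ c ] (E v a × E v b × E v c × a ≢ b × a ≢ c × b ≢ c)

record IsRootedPhylo {m n : ℕ} (E : Rel n) (r : Fin n) (leaf : Fin m → Fin n) : Set where
  field
    leaves   : ∀ v → IsLeafR E r v ⇔ (∃[ x ] leaf x ≡ v)
    internal : ∀ v → ¬ IsLeafR E r v →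
               ∃[ a ] ∃[ b ] (Child E r v a × Child E r v b × a ≢ b)

record PhyloTree (m : ℕ) : Set₁ where
  field
    n       : ℕ
    E       : Rel n
    tree    : IsTree E
    leaf    : Fin m → Fin n
    leafInj : Injective _≡_ _≡_ leaf
    phylo   : IsUnrootedPhylo E leaf ⊎ (∃[ r ] IsRootedPhylo E r leaf)

-- Partitions of X = Fin m, given by their set of blocks.

Blocks : ℕ → Set₁
Blocks m = Subset m → Set

record IsPartition {m : ℕ} (P : Blocks m) : Set where
  field
    nonempty : ∀ A → P A → Nonempty A
    cover    : ∀ x → ∃[ A ] (P A × x ∈ A)
    disjoint : ∀ A B x → P A → P B → x ∈ A → x ∈ B → A ≡ B

_≋_ : ∀ {m} → Blocks m → Blocks m → Set
P ≋ Q = ∀ A → P A ⇔ Q A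

_∧ᵖ_ : ∀ {m} → Blocks m → Blocks m → Blocks m
(P ∧ᵖ Q) A = ∃[ A₁ ] ∃[ A₂ ] (P A₁ × Q A₂ × A ≡ A₁ ∩ A₂ × Nonempty A)

-- iterated common refinement of P₁ ,…, P_k  (k = suc j ≥ 1)
⋀ : ∀ {m} (j : ℕ) → (Fin (suc j) → Blocks m) → Blocks m
⋀ zero    Ps = Ps zero
⋀ (suc j) Ps = Ps zero ∧ᵖ ⋀ j (λ i → Ps (suc i))

-- F(T,H): nonempty leaf sets of connected components of T - H
F : ∀ {m} (T : PhyloTree m) → Rel (PhyloTree.n T) → Blocks m
F T H A = Nonempty A ×
  ∃[ v ] (∀ x → (x ∈ A) ⇔ Connected (PhyloTree.E T minus H) (PhyloTree.leaf T x) v)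

Compatible : ∀ {m} (T : PhyloTree m) → Blocks m → Set₁
Compatible T P = ∃[ H ] ((∀ u v → H u v → PhyloTree.E T u v) × (P ≋ F T H))

{-# OPTIONS --safe #-}
-- The common refinement of F(T,H₁) and F(T,H₂) is F(T,H₁ ∪ H₂): two leaves joined both in
-- T - H₁ and in T - H₂ are joined in T - (H₁ ∪ H₂). Indeed, take a simple path from a to b
-- in T - H₁. If its first edge {a,c} lay in H₂, the path in T - H₂ from a to b followed by
-- the rest of the simple path (which avoids a) back to c would join a and c without using
-- {a,c}, contradicting acyclicity. So that edge survives in T - (H₁ ∪ H₂), and we continue
-- from c.
module Submission where

open import Defs
open import Data.Nat using (ℕ; zero; suc)
open import Data.Fin as Fin using (Fin)
open import Data.Fin.Subset using (Subset; _∈_; _∩_)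
open import Data.Fin.Subset.Properties using (⊆-antisym; ∩⇔×)
open import Data.Product using (Σ; ∃-syntax; _×_; _,_)
open import Data.Product.Function.NonDependent.Propositional using (_×-⇔_)
open import Data.Sum using (_⊎_; inj₁; inj₂; [_,_])
open import Data.Unit.Polymorphic using (⊤)
open import Function using (id; _∘_)
open import Function.Bundles using (_⇔_; mk⇔; Equivalence)
open import Function.Properties.Equivalence using () renaming (sym to ⇔-sym; trans to ⇔-trans)
open import Relation.Binary.Core using (_⇒_)
open import Relation.Binary.Definitions using (DecidableEquality)
open import Relation.Binary.Construct.Union using (_∪_)
open import Relation.Binary.Construct.Closure.ReflexiveTransitive using (Star; ε; _◅_; _◅◅_; gmap; reverse)
open import Relation.Binary.PropositionalEquality using (_≡_; refl)
open import Relation.Nullary using (¬_; Dec; yes; no)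
open import Relation.Nullary.Decidable using (_⊎-dec_)

open Equivalence using (to; from)

module LoopErasure {a r} {A : Set a} (_≟_ : DecidableEquality A) (R : A → A → Set r) where

  Visits : ∀ {x y} → A → Star R x y → Set a
  Visits {x} z ε       = z ≡ x
  Visits {x} z (_ ◅ p) = z ≡ x ⊎ Visits z p

  visits? : ∀ {x y} z (p : Star R x y) → Dec (Visits z p)
  visits? {x} z ε       = z ≟ x
  visits? {x} z (_ ◅ p) = (z ≟ x) ⊎-dec visits? z p

  visits-source : ∀ {x y} (p : Star R x y) → Visits x p
  visits-source ε       = refl
  visits-source (_ ◅ p) = inj₁ refl

  Simple : ∀ {x y} → Star R x y → Set a
  Simple ε           = ⊤
  Simple {x} (_ ◅ p) = ¬ Visits x p × Simple p

  simple-suffix : ∀ {x y z} (p : Star R x y) → Simple p → Visits z p → Σ (Star R z y) Simple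
  simple-suffix ε       _       refl        = ε , _
  simple-suffix (e ◅ p) s       (inj₁ refl) = e ◅ p , s
  simple-suffix (_ ◅ p) (_ , s) (inj₂ z∈p)  = simple-suffix p s z∈p

  loop-erase : ∀ {x y} → Star R x y → Σ (Star R x y) Simple
  loop-erase ε = ε , _
  loop-erase {x} (e ◅ p) with loop-erase p
  ... | p′ , s with visits? x p′
  ...   | yes x∈p′ = simple-suffix p′ s x∈p′
  ...   | no  x∉p′ = e ◅ p′ , x∉p′ , s

module _ {n : ℕ} {E : Rel n} where

  module Paths (H : Rel n) = LoopErasure Fin._≟_ (E minus H)

  connected-antitone : ∀ {H₁ H₂ : Rel n} → (∀ {u v} → H₁ u v → H₂ u v ⊎ H₂ v u) →
                       Connected (E minus H₂) ⇒ Connected (E minus H₁)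
  connected-antitone H₁⊆H₂ =
    gmap id λ (e , ¬h , ¬hᵀ) → e , [ ¬h , ¬hᵀ ] ∘ H₁⊆H₂ , [ ¬hᵀ , ¬h ] ∘ H₁⊆H₂

  avoiding-vertex-avoids-edges : ∀ {H : Rel n} {a d c b} (p : Star (E minus H) c b) →
                                 ¬ Paths.Visits H a p → Connected (E minus single a d) c b
  avoiding-vertex-avoids-edges ε _ = ε
  avoiding-vertex-avoids-edges {H} ((e , _ , _) ◅ p) a∉ =
    (e , (λ { (refl , _) → a∉ (inj₁ refl) }) , (λ { (refl , _) → a∉ (inj₂ (Paths.visits-source H p)) }))
    ◅ avoiding-vertex-avoids-edges p (a∉ ∘ inj₂)

module _ {n : ℕ} {E : Rel n} (tree : IsTree E) where
  open IsTree tree using (sym; acyclic)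
  open module TreePaths (H : Rel n) = Paths {E = E} H using (Visits; Simple; loop-erase)

  minus-sym : ∀ {H : Rel n} {u v} → (E minus H) u v → (E minus H) v u
  minus-sym {u = u} {v} (e , ¬h , ¬hᵀ) = sym u v e , ¬hᵀ , ¬h

  connected-sym : ∀ {H : Rel n} {a b} → Connected (E minus H) a b → Connected (E minus H) b a
  connected-sym {H} = reverse (minus-sym {H})

  connected-via : ∀ {H : Rel n} {a b c} → Connected (E minus H) b c →
                  Connected (E minus H) a b ⇔ Connected (E minus H) a c
  connected-via b~c = mk⇔ (_◅◅ b~c) (_◅◅ connected-sym b~c)

  edge-not-cut : ∀ {H₁ H₂ : Rel n} {a b c} → E a c → Connected (E minus H₂) a b →
                 (p : Star (E minus H₁) c b) → ¬ Visits H₁ a p → ¬ (H₂ a c ⊎ H₂ c a)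
  edge-not-cut {a = a} {c = c} e q p a∉p h =
    acyclic a c e (connected-antitone (λ { (refl , refl) → h }) q
                   ◅◅ reverse (minus-sym {single a c}) (avoiding-vertex-avoids-edges p a∉p))

  simple-connected-∪ : ∀ {H₁ H₂ : Rel n} {a b} (p : Star (E minus H₁) a b) → Simple H₁ p →
                       Connected (E minus H₂) a b → Connected (E minus (H₁ ∪ H₂)) a b
  simple-connected-∪ ε _ _ = ε
  simple-connected-∪ {a = a} ((e , ¬h₁ , ¬h₁ᵀ) ◅ p) (a∉p , s) q =
    (e , [ ¬h₁ , ¬h₂ ∘ inj₁ ] , [ ¬h₁ᵀ , ¬h₂ ∘ inj₂ ])
    ◅ simple-connected-∪ p s ((sym a _ e , ¬h₂ ∘ inj₂ , ¬h₂ ∘ inj₁) ◅ q)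
    where ¬h₂ = edge-not-cut e q p a∉p

  connected-∪⇔ : ∀ {H₁ H₂ : Rel n} {a b} →
                 Connected (E minus (H₁ ∪ H₂)) a b ⇔ (Connected (E minus H₁) a b × Connected (E minus H₂) a b)
  connected-∪⇔ {H₁} = mk⇔
    (λ c → connected-antitone (inj₁ ∘ inj₁) c , connected-antitone (inj₁ ∘ inj₂) c)
    (λ (c₁ , c₂) → let (p , s) = loop-erase H₁ c₁ in simple-connected-∪ p s c₂)

Covers : ∀ {m} → Blocks m → Set
Covers P = ∀ x → ∃[ A ] (P A × x ∈ A)

module _ {m : ℕ} where

  ≋-trans : {P Q R : Blocks m} → P ≋ Q → Q ≋ R → P ≋ R
  ≋-trans P≋Q Q≋R A = ⇔-trans (P≋Q A) (Q≋R A)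

  covers-resp-≋ : {P Q : Blocks m} → P ≋ Q → Covers P → Covers Q
  covers-resp-≋ P≋Q cover x = let (A , A∈P , x∈A) = cover x in A , to (P≋Q A) A∈P , x∈A

  ∧ᵖ-mono : {P P′ Q Q′ : Blocks m} → (∀ A → P A → P′ A) → (∀ A → Q A → Q′ A) →
            ∀ A → (P ∧ᵖ Q) A → (P′ ∧ᵖ Q′) A
  ∧ᵖ-mono f g _ (A₁ , A₂ , A₁∈P , A₂∈Q , eq , ne) = A₁ , A₂ , f A₁ A₁∈P , g A₂ A₂∈Q , eq , ne

  ∧ᵖ-cong : {P P′ Q Q′ : Blocks m} → P ≋ P′ → Q ≋ Q′ → (P ∧ᵖ Q) ≋ (P′ ∧ᵖ Q′)
  ∧ᵖ-cong P≋ Q≋ A = mk⇔ (∧ᵖ-mono (to ∘ P≋) (to ∘ Q≋) A) (∧ᵖ-mono (from ∘ P≋) (from ∘ Q≋) A)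

  ∧ᵖ-covers : {P Q : Blocks m} → Covers P → Covers Q → Covers (P ∧ᵖ Q)
  ∧ᵖ-covers cP cQ x =
    let (A₁ , A₁∈P , x∈A₁) = cP x ; (A₂ , A₂∈Q , x∈A₂) = cQ x ; x∈A = from ∩⇔× (x∈A₁ , x∈A₂)
    in A₁ ∩ A₂ , (A₁ , A₂ , A₁∈P , A₂∈Q , refl , (x , x∈A)) , x∈A

  ∈-extensionality : {p q : Subset m} → (∀ x → x ∈ p ⇔ x ∈ q) → p ≡ q
  ∈-extensionality p⇔q = ⊆-antisym (to (p⇔q _)) (from (p⇔q _))

  ⋀-covers : ∀ j (Ps : Fin (suc j) → Blocks m) → (∀ i → Covers (Ps i)) → Covers (⋀ j Ps)
  ⋀-covers zero    Ps cs = cs Fin.zero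
  ⋀-covers (suc j) Ps cs = ∧ᵖ-covers (cs Fin.zero) (⋀-covers j (Ps ∘ Fin.suc) (cs ∘ Fin.suc))

module _ {m : ℕ} (T : PhyloTree m) where
  open PhyloTree T using (E; tree; leaf)

  block-membership : ∀ {H A x₀} → F T H A → x₀ ∈ A →
                     ∀ x → x ∈ A ⇔ Connected (E minus H) (leaf x) (leaf x₀)
  block-membership (_ , _ , mem) x₀∈A x =
    ⇔-trans (mem x) (⇔-sym (connected-via tree (to (mem _) x₀∈A)))

  meet-membership : ∀ {H₁ H₂ A₁ A₂ x₀} → F T H₁ A₁ → F T H₂ A₂ → x₀ ∈ A₁ ∩ A₂ →
                    ∀ x → x ∈ A₁ ∩ A₂ ⇔ Connected (E minus (H₁ ∪ H₂)) (leaf x) (leaf x₀)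
  meet-membership A₁∈F A₂∈F x₀∈ x =
    let (x₀∈A₁ , x₀∈A₂) = to ∩⇔× x₀∈
    in ⇔-trans ∩⇔× (⇔-trans (block-membership A₁∈F x₀∈A₁ x ×-⇔ block-membership A₂∈F x₀∈A₂ x)
                            (⇔-sym (connected-∪⇔ tree)))

  -- Constructively F T H need not cover X (connectivity in T - H is undecidable), so
  -- the blocks meeting a given leaf are supplied by the coverage hypotheses.
  F-∧ᵖ : ∀ {H₁ H₂} → Covers (F T H₁) → Covers (F T H₂) → (F T H₁ ∧ᵖ F T H₂) ≋ F T (H₁ ∪ H₂)
  F-∧ᵖ cover₁ cover₂ A = mk⇔ meet⇒F F⇒meet
    where
    meet⇒F : (F T _ ∧ᵖ F T _) A → F T _ A
    meet⇒F (_ , _ , A₁∈F , A₂∈F , refl , (x₀ , x₀∈A)) =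
      (x₀ , x₀∈A) , leaf x₀ , meet-membership A₁∈F A₂∈F x₀∈A

    F⇒meet : F T _ A → (F T _ ∧ᵖ F T _) A
    F⇒meet A∈F@((x₀ , x₀∈A) , _) =
      let (A₁ , A₁∈F , x₀∈A₁) = cover₁ x₀ ; (A₂ , A₂∈F , x₀∈A₂) = cover₂ x₀
          x₀∈A₁∩A₂ = from ∩⇔× (x₀∈A₁ , x₀∈A₂)
      in A₁ , A₂ , A₁∈F , A₂∈F
       , ∈-extensionality (λ x → ⇔-trans (block-membership A∈F x₀∈A x)
                                         (⇔-sym (meet-membership A₁∈F A₂∈F x₀∈A₁∩A₂ x)))
       , (x₀ , x₀∈A)

  compatible-∧ᵖ : ∀ {P Q} → Covers P → Covers Q → Compatible T P → Compatible T Q → Compatible T (P ∧ᵖ Q)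
  compatible-∧ᵖ cP cQ (H₁ , H₁⊆E , P≋) (H₂ , H₂⊆E , Q≋) =
    H₁ ∪ H₂ , (λ u v → [ H₁⊆E u v , H₂⊆E u v ]) ,
    ≋-trans (∧ᵖ-cong P≋ Q≋) (F-∧ᵖ (covers-resp-≋ P≋ cP) (covers-resp-≋ Q≋ cQ))

  ⋀-compatible : ∀ j (Ps : Fin (suc j) → Blocks m) → (∀ i → Covers (Ps i)) →
                 (∀ i → Compatible T (Ps i)) → Compatible T (⋀ j Ps)
  ⋀-compatible zero    Ps cs cc = cc Fin.zero
  ⋀-compatible (suc j) Ps cs cc =
    compatible-∧ᵖ (cs Fin.zero) (⋀-covers j (Ps ∘ Fin.suc) (cs ∘ Fin.suc))
                  (cc Fin.zero) (⋀-compatible j (Ps ∘ Fin.suc) (cs ∘ Fin.suc) (cc ∘ Fin.suc))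

proposition5p10 : ∀ {m : ℕ} (T : PhyloTree m) (j : ℕ) (Ps : Fin (suc j) → Blocks m) →
    (∀ i → IsPartition (Ps i)) → (∀ i → Compatible T (Ps i)) →
    Compatible T (⋀ j Ps)
proposition5p10 T j Ps partitions = ⋀-compatible T j Ps (IsPartition.cover ∘ partitions)
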